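{- Let $I$ be a finite multiset with elements in $\{0,\ldots,n\}$, let $\ell\in\{0,\ldots,n\}$, and let $\tilde I$ be the multiset sum of $I$ and $\{\ell\}$. (i) Suppose $\ell\in\hat I$ or $\ell\in\{0,n\}$. Let $r_\ell=n-\hat k+|\{j\in\hat I\cup\{n\}:j>\ell\}|$; this is the value of $r$ for the added copy of $\ell$, viewed as an element of $\tilde I\setminus\hat{\tilde I}$. Then $R_{n,\tilde I}=e_{r_\ell}R_{n,I}$ and $R^{\mathrm{hom}}_{n,\tilde I}=e_\ell R^{\mathrm{hom}}_{n,I}$. (ii) Suppose $\ell\in\{1,\ldots,n-1\}\setminus\hat I$. Then $R^{\mathrm{hom}}_{n,\tilde I}$ is the sum of $e_\ell R^{\mathrm{hom}}_{n,I}$ and of the spaces $\big(\prod_{i\in\tilde I\setminus\operatorname{Dsp}^c(C)}e_i\big)V_C$, over all cocharge tableaux $C$ (of all shapes $\lambda\vdash n$) with $\ell\in\operatorname{Dsp}^c(C)\subseteq\hat{\tilde I}$. (iii) For $\ell$ as in (ii), $R_{n,\tilde I}$ is the sum of the following two kinds of spaces: - the spaces $\big(\prod_{i\in\tilde I\setminus\operatorname{Dsp}^c(C)}e_{r_i}\big)V_C$, with $r_i$ computed with respect to $\tilde I$, over the same set of cocharge tableaux $C$ as in (ii); - for each cocharge tableau $C$ with $\operatorname{Dsp}^c(C)\subseteq\hat I$, the image of the summand $\big(\prod_{i\in I\setminus\operatorname{Dsp}^c(C)}e_{r_i}\big)V_C$ of $R_{n,I}$ (with $r_i$ computed with respect to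 $I$) under multiplying by $e_{r_\ell}$ and replacing each factor $e_{r_i}$ with $i>\ell$ by $e_{r_i-1}$. Here $r_\ell=|\{j\in\{1,\ldots,n-1\}\setminus\hat I:j<\ell\}|$.
   Context: $S_n$ acts on $\mathbb{Q}[x_1,\ldots,x_n]$ by permuting variables. $e_r$ is the $r$-th elementary symmetric polynomial in $x_1,\ldots,x_n$, with $e_0=1$. Multisets: - For a multiset $I$ with elements in $\{0,\ldots,n\}$, $\hat I$ is the set of elements of $\{1,\ldots,n-1\}$ occurring in $I$, and $\hat k=|\hat I|+1$. - For $D\subseteq\hat I$, $I\setminus D$ is $I$ with one copy of each element of $D$ removed. - For $i\in\hat I\setminus D$, $r_i=|\{j\in\{1,\ldots,n-1\}\setminus\hat I:j<i\}|$. For $i$ in the multiset $I\setminus\hat I$, $r_i=n-\hat k+|\{j\in\hat I\cup\{n\}:j>i\}|$. Tableaux: for $S\in\operatorname{SYT}(\lambda)$, $\lambda\vdash n$, $\operatorname{Dsi}(S)$ is the set of $i$ with $i+1$ in a strictly lower row than $i$. A cocharge tableau is $C=\operatorname{ct}(S)$, which has $|\{i\in\operatorname{Dsi}(S):i<p\}|$ in the box containing $p$, and $\operatorname{Dsp}^c(C)=\{n-i:i\in\operatorname{Dsi}(S)\}$. Specht polynomials: for $T$ a filling of $\lambda$ by $1,\ldots,n$, each used once, $\varepsilon_T=\sum_{\sigma\in C(T)}\sum_{\tau\in R(T)}\operatorname{sgn}(\sigma)\sigma\tau$. $p_{C,T}=\prod x_i^{h_i}$, where $h_i$ is the entry of $C$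 in the box of $T$ containing $i$. $s_{C,T}$ is the order of the stabilizer of $p_{C,T}$ in $R(T)$, $F_{C,T}=\varepsilon_Tp_{C,T}/s_{C,T}$, and $V_C$ is the span of all $F_{C,T}$. Representations: - $R_{n,I}=\sum_{\lambda\vdash n}\sum_{C\text{ cocharge of shape }\lambda,\,\operatorname{Dsp}^c(C)\subseteq\hat I}\big(\prod_{i\in I\setminus\operatorname{Dsp}^c(C)}e_{r_i}\big)V_C$; - $R^{\mathrm{hom}}_{n,I}=\sum_{\lambda\vdash n}\sum_{C\text{ cocharge of shape }\lambda,\,\operatorname{Dsp}^c(C)\subseteq\hat I}\big(\prod_{i\in I\setminus\operatorname{Dsp}^c(C)}e_i\big)V_C$. -}

module Defs where

open import Data.Nat as ℕ using (ℕ; zero; suc; _∸_; _<ᵇ_; _≡ᵇ_; _≤ᵇ_; _<_; _≤_)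
open import Data.Integer as ℤ using (ℤ; +_; -[1+_])
open import Data.Rational as ℚ using (ℚ; 0ℚ; 1ℚ)
open import Data.Bool using (Bool; true; false; if_then_else_; _∧_; _∨_; not)
open import Data.Fin as Fin using (Fin; toℕ; fromℕ<)
open import Data.Vec as Vec using (Vec; []; _∷_; lookup; tabulate; zipWith)
import Data.Vec.Properties as VecP
open import Data.List as List using (List; []; _∷_; map; length; foldr; concatMap; allFin; filterᵇ; _++_)
open import Data.Product using (Σ; ∃; _×_; _,_; proj₁; proj₂)
open import Relation.Nullary using (yes; no; does)
open import Relation.Binary.PropositionalEquality using (_≡_)

-- [a, a+1, ..., b]  (empty if b < a)
range : ℕ → ℕ → List ℕ
range a b = map (ℕ._+ a) (List.upTo (suc b ∸ a))

countᵇ : {A : Set} → (A → Bool) → List A → ℕ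
countᵇ p xs = length (filterᵇ p xs)

anyᵇ : {A : Set} → (A → Bool) → List A → Bool
anyᵇ p = foldr (λ x b → p x ∨ b) false

allᵇ : {A : Set} → (A → Bool) → List A → Bool
allᵇ p = foldr (λ x b → p x ∧ b) true

sumℕ : List ℕ → ℕ
sumℕ = foldr ℕ._+_ 0

-- Polynomials in Q[x_1,...,x_n]; variable x_{i+1} is indexed by i : Fin n.
-- A polynomial is a finite list of terms (coefficient, exponent vector);
-- polynomials are compared through their coefficient functions.

Mon : ℕ → Set
Mon n = Vec ℕ n

Pol : ℕ → Set
Pol n = List (ℚ × Mon n)

coeff : {n : ℕ} → Pol n → Mon n → ℚ
coeff [] m = 0ℚ
coeff ((c , m') ∷ p) m =
  (if does (VecP.≡-dec ℕ._≟_ m' m) then c else 0ℚ) ℚ.+ coeff p m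

infix 4 _≈P_
_≈P_ : {n : ℕ} → Pol n → Pol n → Set
p ≈P q = ∀ m → coeff p m ≡ coeff q m

0P : {n : ℕ} → Pol n
0P = []

1P : {n : ℕ} → Pol n
1P {n} = (1ℚ , Vec.replicate n 0) ∷ []

_+P_ : {n : ℕ} → Pol n → Pol n → Pol n
p +P q = p ++ q

scale : {n : ℕ} → ℚ → Pol n → Pol n
scale c = map (λ t → (c ℚ.* proj₁ t , proj₂ t))

_*P_ : {n : ℕ} → Pol n → Pol n → Pol n
p *P q = concatMap (λ t → map (λ u → (proj₁ t ℚ.* proj₁ u , zipWith ℕ._+_ (proj₂ t) (proj₂ u))) q) p

sumP : {n : ℕ} → List (Pol n) → Pol n
sumP = foldr _+P_ 0P

prodP : {n : ℕ} → List (Pol n) → Pol n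
prodP = foldr _*P_ 1P

powP : {n : ℕ} → Pol n → ℕ → Pol n
powP p zero = 1P
powP p (suc k) = p *P powP p k

allVecs : {A : Set} → (k : ℕ) → List A → List (Vec A k)
allVecs zero xs = [] ∷ []
allVecs (suc k) xs = concatMap (λ x → map (x ∷_) (allVecs k xs)) xs

-- elementary symmetric polynomial e_r (e_0 = 1, e_r = 0 for r > n)
e : {n : ℕ} → ℕ → Pol n
e {n} r = map (λ v → (1ℚ , Vec.map (λ b → if b then 1 else 0) v))
              (filterᵇ (λ v → countᵇ (λ b → b) (Vec.toList v) ≡ᵇ r)
                       (allVecs n (true ∷ false ∷ [])))

eZ : {n : ℕ} → ℤ → Pol n
eZ (+ r) = e r
eZ -[1+ _ ] = 0P

-- The symmetric group S_n: a permutation is the vector of images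
-- (σ(0),...,σ(n-1)), required to be injective.

Perm : ℕ → Set
Perm n = Vec (Fin n) n

finEqᵇ : {n : ℕ} → Fin n → Fin n → Bool
finEqᵇ i j = does (i Fin.≟ j)

isPermᵇ : {n : ℕ} → Perm n → Bool
isPermᵇ {n} σ = allᵇ (λ i → allᵇ (λ j → finEqᵇ i j ∨ not (finEqᵇ (lookup σ i) (lookup σ j))) (allFin n)) (allFin n)

allPerms : (n : ℕ) → List (Perm n)
allPerms n = filterᵇ isPermᵇ (allVecs n (allFin n))

inversions : {n : ℕ} → Perm n → ℕ
inversions {n} σ = countᵇ (λ ij → (toℕ (proj₁ ij) <ᵇ toℕ (proj₂ ij)) ∧ (toℕ (lookup σ (proj₂ ij)) <ᵇ toℕ (lookup σ (proj₁ ij))))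
                          (concatMap (λ i → map (i ,_) (allFin n)) (allFin n))

sgn : {n : ℕ} → Perm n → ℚ
sgn σ = if (inversions σ ℕ.% 2) ≡ᵇ 0 then 1ℚ else ℚ.- 1ℚ

-- σ acts by x_i ↦ x_{σ(i)}: the exponent of x_j in σ·m is m_i where σ(i) = j
actMon : {n : ℕ} → Perm n → Mon n → Mon n
actMon {n} σ m = tabulate (λ j → sumℕ (map (λ i → if finEqᵇ (lookup σ i) j then lookup m i else 0) (allFin n)))

act : {n : ℕ} → Perm n → Pol n → Pol n
act σ = map (λ t → (proj₁ t , actMon σ (proj₂ t)))

-- Partitions, fillings, standard Young tableaux.
-- A shape is the list of row lengths; boxes are (row , column), 0-based,
-- row 0 on top. Entries 1..n are represented by Fin n (entry k+1 ↔ k).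

rowLen : List ℕ → ℕ → ℕ
rowLen [] r = 0
rowLen (a ∷ sh) zero = a
rowLen (a ∷ sh) (suc r) = rowLen sh r

decreasingPosᵇ : List ℕ → Bool
decreasingPosᵇ [] = true
decreasingPosᵇ (a ∷ []) = 1 ≤ᵇ a
decreasingPosᵇ (a ∷ b ∷ sh) = (b ≤ᵇ a) ∧ decreasingPosᵇ (b ∷ sh)

IsPartition : ℕ → List ℕ → Set
IsPartition n sh = (decreasingPosᵇ sh ≡ true) × (sumℕ sh ≡ n)

-- a filling of shape sh by 1..n, each used once: pos i is the box containing entry i
record Filling (n : ℕ) (sh : List ℕ) : Set where
  field
    pos     : Fin n → ℕ × ℕ
    inShape : ∀ i → proj₂ (pos i) < rowLen sh (proj₁ (pos i))
    inj     : ∀ i j → pos i ≡ pos j → i ≡ j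
    surj    : ∀ r c → c < rowLen sh r → ∃ λ i → pos i ≡ (r , c)
open Filling public

row col : {n : ℕ} {sh : List ℕ} → Filling n sh → Fin n → ℕ
row T i = proj₁ (pos T i)
col T i = proj₂ (pos T i)

IsStandard : {n : ℕ} {sh : List ℕ} → Filling n sh → Set
IsStandard T = (∀ i j → row T i ≡ row T j → col T i < col T j → toℕ i < toℕ j)
             × (∀ i j → col T i ≡ col T j → row T i < row T j → toℕ i < toℕ j)

-- a cocharge tableau C = ct(S), given by its shape and the SYT S
record Coch (n : ℕ) : Set where
  field
    shape : List ℕ
    isPart : IsPartition n shape
    syt : Filling n shape
    std : IsStandard syt
open Coch public

-- box containing entry p (1-based); (0,0) if p is not in 1..n
posAt : {n : ℕ} {sh : List ℕ} → Filling n sh → ℕ → ℕ × ℕ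
posAt {n} T zero = (0 , 0)
posAt {n} T (suc p) with p ℕ.<? n
... | yes p<n = pos T (fromℕ< p<n)
... | no _ = (0 , 0)

dsiᵇ : {n : ℕ} → Coch n → ℕ → Bool
dsiᵇ {n} C d = (1 ≤ᵇ d) ∧ (d <ᵇ n) ∧ (proj₁ (posAt (syt C) d) <ᵇ proj₁ (posAt (syt C) (suc d)))

-- entry of ct(S) in the box containing entry p of S
ctEntry : {n : ℕ} → Coch n → ℕ → ℕ
ctEntry {n} C p = countᵇ (λ d → dsiᵇ C d ∧ (d <ᵇ p)) (range 1 n)

dspᵇ : {n : ℕ} → Coch n → ℕ → Bool
dspᵇ {n} C k = anyᵇ (λ d → dsiᵇ C d ∧ ((n ∸ d) ≡ᵇ k)) (range 1 n)

pairEqᵇ : ℕ × ℕ → ℕ × ℕ → Bool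
pairEqᵇ (a , b) (c , d) = (a ≡ᵇ c) ∧ (b ≡ᵇ d)

-- h_i = entry of C in the box of T containing i
hExp : {n : ℕ} (C : Coch n) → Filling n (shape C) → Fin n → ℕ
hExp {n} C T i = sumℕ (map (λ q → if pairEqᵇ (pos (syt C) q) (pos T i) then ctEntry C (suc (toℕ q)) else 0) (allFin n))

pCT : {n : ℕ} (C : Coch n) → Filling n (shape C) → Pol n
pCT C T = (1ℚ , tabulate (hExp C T)) ∷ []

rowGroup colGroup : {n : ℕ} {sh : List ℕ} → Filling n sh → List (Perm n)
rowGroup {n} T = filterᵇ (λ σ → allᵇ (λ i → row T (lookup σ i) ≡ᵇ row T i) (allFin n)) (allPerms n)
colGroup {n} T = filterᵇ (λ σ → allᵇ (λ i → col T (lookup σ i) ≡ᵇ col T i) (allFin n)) (allPerms n)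

epsT : {n : ℕ} {sh : List ℕ} → Filling n sh → Pol n → Pol n
epsT T p = sumP (concatMap (λ σ → map (λ τ → scale (sgn σ) (act σ (act τ p))) (rowGroup T)) (colGroup T))

monEqᵇ : {n : ℕ} → Mon n → Mon n → Bool
monEqᵇ m m' = does (VecP.≡-dec ℕ._≟_ m m')

sCT : {n : ℕ} (C : Coch n) → Filling n (shape C) → ℕ
sCT C T = countᵇ (λ τ → monEqᵇ (actMon τ (tabulate (hExp C T))) (tabulate (hExp C T))) (rowGroup T)

invℕ : ℕ → ℚ
invℕ zero = 0ℚ
invℕ (suc k) = (+ 1) ℚ./ (suc k)

FCT : {n : ℕ} (C : Coch n) → Filling n (shape C) → Pol n
FCT C T = scale (invℕ (sCT C T)) (epsT T (pCT C T))

-- Subspaces of Q[x_1..x_n], as predicates on polynomials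

Subsp : ℕ → Set₁
Subsp n = Pol n → Set

Span : {n : ℕ} {A : Set} → (A → Pol n) → Subsp n
Span {n} {A} f p = Σ (List (ℚ × A)) λ cs → sumP (map (λ ca → scale (proj₁ ca) (f (proj₂ ca))) cs) ≈P p

mulSp : {n : ℕ} → Pol n → Subsp n → Subsp n
mulSp {n} g V p = Σ (Pol n) λ v → V v × ((g *P v) ≈P p)

SumSp : {n : ℕ} {A : Set} → (A → Subsp n) → Subsp n
SumSp {n} {A} V p = Σ (List (Σ A λ a → Σ (Pol n) (V a))) λ xs → sumP (map (λ x → proj₁ (proj₂ x)) xs) ≈P p

_⊕_ : {n : ℕ} → Subsp n → Subsp n → Subsp n
_⊕_ {n} V W p = Σ (Pol n) λ v → Σ (Pol n) λ w → V v × W w × ((v +P w) ≈P p)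

infix 4 _≐_
_≐_ : {n : ℕ} → Subsp n → Subsp n → Set
V ≐ W = ∀ p → (V p → W p) × (W p → V p)

VC : {n : ℕ} → Coch n → Subsp n
VC C = Span (FCT C)

-- Multisets I with elements in {0..n}: lists of naturals (order irrelevant)

mult : ℕ → List ℕ → ℕ
mult v I = countᵇ (v ≡ᵇ_) I

hatᵇ : ℕ → List ℕ → ℕ → Bool
hatᵇ n I i = (1 ≤ᵇ i) ∧ (i <ᵇ n) ∧ (1 ≤ᵇ mult i I)

khat : ℕ → List ℕ → ℕ
khat n I = suc (countᵇ (hatᵇ n I) (range 1 (n ∸ 1)))

-- r_i for i ∈ Î \ D
rA : ℕ → List ℕ → ℕ → ℤ
rA n I i = + countᵇ (λ j → not (hatᵇ n I j) ∧ (j <ᵇ i)) (range 1 (n ∸ 1))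

-- r_i for i in the multiset I \ Î
rB : ℕ → List ℕ → ℕ → ℤ
rB n I i = ((+ n) ℤ.- (+ khat n I)) ℤ.+ (+ countᵇ (λ j → (hatᵇ n I j ∨ (j ≡ᵇ n)) ∧ (i <ᵇ j)) (range 1 n))

-- ∏_{i ∈ I \ D} e_{f(i, r_i)}, D ⊆ Î given by a Boolean predicate.
-- I \ D is the multiset sum of (Î \ D) and I \ Î.
prodR : (n : ℕ) → List ℕ → (ℕ → Bool) → (ℕ → ℤ → ℤ) → Pol n
prodR n I D f =
  prodP (map (λ i → eZ (f i (rA n I i))) (filterᵇ (λ i → hatᵇ n I i ∧ not (D i)) (range 1 (n ∸ 1))))
  *P prodP (map (λ v → powP (eZ (f v (rB n I v))) (mult v I ∸ (if hatᵇ n I v then 1 else 0))) (range 0 n))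

prodH : (n : ℕ) → List ℕ → (ℕ → Bool) → Pol n
prodH n I D = prodP (map (λ v → powP (e v) (mult v I ∸ (if D v then 1 else 0))) (range 0 n))

DspSub : {n : ℕ} → Coch n → (ℕ → Bool) → Set
DspSub C P = ∀ k → dspᵇ C k ≡ true → P k ≡ true

R : (n : ℕ) → List ℕ → Subsp n
R n I = SumSp {A = Σ (Coch n) λ C → DspSub C (hatᵇ n I)}
              (λ a → mulSp (prodR n I (dspᵇ (proj₁ a)) (λ _ r → r)) (VC (proj₁ a)))

Rhom : (n : ℕ) → List ℕ → Subsp n
Rhom n I = SumSp {A = Σ (Coch n) λ C → DspSub C (hatᵇ n I)}
                 (λ a → mulSp (prodH n I (dspᵇ (proj₁ a))) (VC (proj₁ a)))

-- Adding ℓ to I changes each summand (∏ e_{r_i}) V_C of R_{n,I} and R^hom_{n,I} only through its scalar factor.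
-- If Î does not change, neither do k̂ and the r_i, and the new copy of ℓ contributes one extra factor e_{r_ℓ}
-- (resp. e_ℓ) to every summand, so the whole sum is multiplied by it. If ℓ is new in Î, the tableaux with
-- Dsp^c(C) ⊆ Î ∪ {ℓ} split according to whether ℓ ∈ Dsp^c(C). Those with ℓ ∈ Dsp^c(C) give the new summands; for
-- the others ℓ lies in Î ∖ D and contributes e_{r_ℓ} (resp. e_ℓ), while every r_i with i > ℓ drops by one: for
-- i ∈ Î because ℓ has left the complement of Î below i, for i ∈ I ∖ Î because k̂ grows by one while ℓ is not
-- above i (for i < ℓ the two changes cancel).
--
-- Polynomials are compared coefficientwise, which makes them a commutative semiring, and a sum of subspaces is
-- handled as the least additive submonoid containing the summands.
{-# OPTIONS --safe #-}
module Submission where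

open import Defs
open import Algebra.Bundles using (CommutativeMonoid; CommutativeSemiring)
import Algebra.Properties.CommutativeSemigroup as CommSemigroupProperties
open import Algebra.Structures.Biased using (isCommutativeSemiringˡ)
open import Data.Bool using (Bool; true; false; if_then_else_; _∧_; _∨_; not)
import Data.Bool.Properties as BoolP
open import Data.Integer as ℤ using (ℤ; +_; _-_)
open import Data.Integer.Tactic.RingSolver using (solve-∀)
open import Data.List using (List; []; _∷_; _++_; map; filterᵇ; length; applyUpTo)
import Data.List.Properties as ListP
open import Data.List.Relation.Unary.All using (All)
open import Data.Nat as ℕ using (ℕ; zero; suc; _≤_; _<_; _∸_; _<ᵇ_; _≤ᵇ_; _≡ᵇ_)
import Data.Nat.Properties as ℕP
open import Data.Product using (Σ; ∃; _×_; _,_; proj₁; proj₂)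
open import Data.Rational as ℚ using (ℚ; 0ℚ; 1ℚ)
import Data.Rational.Properties as ℚP
open import Data.Sum using (_⊎_; inj₁; inj₂)
open import Data.Vec as Vec using ([]; _∷_; zipWith)
import Data.Vec.Properties as VecP
open import Function using (_∘_; _⇔_; mk⇔; Equivalence)
open import Level using (0ℓ)
open import Relation.Binary.Bundles using (Setoid)
open import Relation.Binary.PropositionalEquality
  using (_≡_; _≢_; refl; sym; trans; cong; cong₂; subst; module ≡-Reasoning)
open import Relation.Nullary using (¬_; Dec; yes; no; does; contradiction)
open import Relation.Nullary.Decidable using (does-⇔; dec-true; dec-false)

_⊹_ : {n : ℕ} → Mon n → Mon n → Mon n
_⊹_ = zipWith ℕ._+_

⊹-cancelˡ : {n : ℕ} (b : Mon n) {a a′ : Mon n} → b ⊹ a ≡ b ⊹ a′ → a ≡ a′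
⊹-cancelˡ []      {[]}    {[]}      _  = refl
⊹-cancelˡ (x ∷ b) {y ∷ a} {y′ ∷ a′} eq =
  cong₂ _∷_ (ℕP.+-cancelˡ-≡ x y y′ (VecP.∷-injectiveˡ eq)) (⊹-cancelˡ b (VecP.∷-injectiveʳ eq))

infix 4 _∣ᴹ_ _∣ᴹ?_
_∣ᴹ_ : {n : ℕ} → Mon n → Mon n → Set
b ∣ᴹ m = ∃ λ d → b ⊹ d ≡ m

_∣ᴹ?_ : {n : ℕ} (b m : Mon n) → Dec (b ∣ᴹ m)
[]      ∣ᴹ? []      = yes ([] , refl)
(x ∷ b) ∣ᴹ? (z ∷ m) with x ℕ.≤? z | b ∣ᴹ? m
... | yes x≤z | yes (d , b⊹d≡m) = yes (z ∸ x ∷ d , cong₂ _∷_ (ℕP.m+[n∸m]≡n x≤z) b⊹d≡m)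
... | no x≰z  | _               = no λ { (y ∷ d , eq) → x≰z (subst (x ≤_) (VecP.∷-injectiveˡ eq) (ℕP.m≤m+n x y)) }
... | _       | no b∤m          = no λ { (y ∷ d , eq) → b∤m (d , VecP.∷-injectiveʳ eq) }

Term : ℕ → Set
Term n = ℚ × Mon n

_·ᵗ_ : {n : ℕ} → Term n → Term n → Term n
t ·ᵗ u = (proj₁ t ℚ.* proj₁ u , proj₂ t ⊹ proj₂ u)

·ᵗ-comm : {n : ℕ} (t u : Term n) → t ·ᵗ u ≡ u ·ᵗ t
·ᵗ-comm (c , a) (d , b) = cong₂ _,_ (ℚP.*-comm c d) (VecP.zipWith-comm ℕP.+-comm a b)

·ᵗ-assoc : {n : ℕ} (t u w : Term n) → (t ·ᵗ u) ·ᵗ w ≡ t ·ᵗ (u ·ᵗ w)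
·ᵗ-assoc (c , a) (d , b) (f , g) = cong₂ _,_ (ℚP.*-assoc c d f) (VecP.zipWith-assoc ℕP.+-assoc a b g)

termCoeff : {n : ℕ} → Term n → Mon n → ℚ
termCoeff (c , a) m = if does (VecP.≡-dec ℕ._≟_ a m) then c else 0ℚ

*-if-0 : (b : Bool) (c x : ℚ) → c ℚ.* (if b then x else 0ℚ) ≡ (if b then c ℚ.* x else 0ℚ)
*-if-0 true  c x = refl
*-if-0 false c x = ℚP.*-zeroʳ c

termCoeff-·ᵗ-∣ : {n : ℕ} (c : ℚ) {b d m : Mon n} → b ⊹ d ≡ m → (u : Term n) →
  termCoeff ((c , b) ·ᵗ u) m ≡ c ℚ.* termCoeff u d
termCoeff-·ᵗ-∣ c {b} {d} {m} b⊹d≡m (c′ , a) = begin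
  (if does (VecP.≡-dec ℕ._≟_ (b ⊹ a) m) then c ℚ.* c′ else 0ℚ)
    ≡⟨ cong (λ β → if β then c ℚ.* c′ else 0ℚ) (does-⇔ shifted (VecP.≡-dec ℕ._≟_ (b ⊹ a) m) (VecP.≡-dec ℕ._≟_ a d)) ⟩
  (if does (VecP.≡-dec ℕ._≟_ a d) then c ℚ.* c′ else 0ℚ)
    ≡⟨ *-if-0 _ c c′ ⟨
  c ℚ.* termCoeff (c′ , a) d ∎
  where
  open ≡-Reasoning
  shifted : b ⊹ a ≡ m ⇔ a ≡ d
  shifted = mk⇔ (λ eq → ⊹-cancelˡ b (trans eq (sym b⊹d≡m))) (λ { refl → b⊹d≡m })

termCoeff-·ᵗ-∤ : {n : ℕ} (c : ℚ) {b m : Mon n} → ¬ b ∣ᴹ m → (u : Term n) → termCoeff ((c , b) ·ᵗ u) m ≡ 0ℚ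
termCoeff-·ᵗ-∤ c {b} {m} b∤m (c′ , a) with VecP.≡-dec ℕ._≟_ (b ⊹ a) m
... | yes b⊹a≡m = contradiction (a , b⊹a≡m) b∤m
... | no _ = refl


coeff-++ : {n : ℕ} (p q : Pol n) (m : Mon n) → coeff (p ++ q) m ≡ coeff p m ℚ.+ coeff q m
coeff-++ []      q m = sym (ℚP.+-identityˡ (coeff q m))
coeff-++ (t ∷ p) q m =
  trans (cong (termCoeff t m ℚ.+_) (coeff-++ p q m)) (sym (ℚP.+-assoc (termCoeff t m) (coeff p m) (coeff q m)))

coeff-map-·ᵗ-∣ : {n : ℕ} (c : ℚ) {b d m : Mon n} → b ⊹ d ≡ m → (q : Pol n) →
  coeff (map ((c , b) ·ᵗ_) q) m ≡ c ℚ.* coeff q d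
coeff-map-·ᵗ-∣ c b⊹d≡m []      = sym (ℚP.*-zeroʳ c)
coeff-map-·ᵗ-∣ c b⊹d≡m (u ∷ q) =
  trans (cong₂ ℚ._+_ (termCoeff-·ᵗ-∣ c b⊹d≡m u) (coeff-map-·ᵗ-∣ c b⊹d≡m q)) (sym (ℚP.*-distribˡ-+ c _ _))

coeff-map-·ᵗ-∤ : {n : ℕ} (c : ℚ) {b m : Mon n} → ¬ b ∣ᴹ m → (q : Pol n) → coeff (map ((c , b) ·ᵗ_) q) m ≡ 0ℚ
coeff-map-·ᵗ-∤ c b∤m []      = refl
coeff-map-·ᵗ-∤ c b∤m (u ∷ q) =
  trans (cong₂ ℚ._+_ (termCoeff-·ᵗ-∤ c b∤m u) (coeff-map-·ᵗ-∤ c b∤m q)) (ℚP.+-identityˡ 0ℚ)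

-- A record rather than _≈P_ itself, so that both polynomials can be inferred from a proof.
infix 4 _≋_
record _≋_ {n : ℕ} (p q : Pol n) : Set where
  constructor mk≋
  field coeff-≡ : p ≈P q
open _≋_ public

≋-setoid : ℕ → Setoid 0ℓ 0ℓ
≋-setoid n = record
  { Carrier       = Pol n
  ; _≈_           = _≋_
  ; isEquivalence = record
    { refl  = mk≋ λ m → refl
    ; sym   = λ p≋q → mk≋ λ m → sym (coeff-≡ p≋q m)
    ; trans = λ p≋q q≋r → mk≋ λ m → trans (coeff-≡ p≋q m) (coeff-≡ q≋r m)
    }
  }

module _ {n : ℕ} where
  open Setoid (≋-setoid n) using () renaming (refl to ≋-refl; reflexive to ≡⇒≋)

  ++-cong : {p p′ q q′ : Pol n} → p ≋ p′ → q ≋ q′ → p ++ q ≋ p′ ++ q′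
  ++-cong {p} {p′} {q} {q′} p≋p′ q≋q′ = mk≋ λ m →
    trans (coeff-++ p q m) (trans (cong₂ ℚ._+_ (coeff-≡ p≋p′ m) (coeff-≡ q≋q′ m)) (sym (coeff-++ p′ q′ m)))

  ++-comm : (p q : Pol n) → p ++ q ≋ q ++ p
  ++-comm p q = mk≋ λ m →
    trans (coeff-++ p q m) (trans (ℚP.+-comm (coeff p m) (coeff q m)) (sym (coeff-++ q p m)))

  coeff-map-·ᵗ-cong : (t : Term n) {q q′ : Pol n} → q ≋ q′ → ∀ m → coeff (map (t ·ᵗ_) q) m ≡ coeff (map (t ·ᵗ_) q′) m
  coeff-map-·ᵗ-cong (c , b) {q} {q′} q≋q′ m with b ∣ᴹ? m
  ... | yes (d , b⊹d≡m) = trans (coeff-map-·ᵗ-∣ c b⊹d≡m q)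
                                (trans (cong (c ℚ.*_) (coeff-≡ q≋q′ d)) (sym (coeff-map-·ᵗ-∣ c b⊹d≡m q′)))
  ... | no b∤m          = trans (coeff-map-·ᵗ-∤ c b∤m q) (sym (coeff-map-·ᵗ-∤ c b∤m q′))

  *-congˡ : (p : Pol n) {q q′ : Pol n} → q ≋ q′ → p *P q ≋ p *P q′
  *-congˡ []      q≋q′ = ≋-refl
  *-congˡ (t ∷ p) {q} {q′} q≋q′ =
    ++-cong {map (t ·ᵗ_) q} {map (t ·ᵗ_) q′} (mk≋ (coeff-map-·ᵗ-cong t q≋q′)) (*-congˡ p q≋q′)

  *-distribʳ-++ : (p q r : Pol n) → (q ++ r) *P p ≡ q *P p ++ r *P p
  *-distribʳ-++ p = ListP.concatMap-++ (λ t → map (t ·ᵗ_) p)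

  map-·ᵗ-*P : (t : Term n) (q r : Pol n) → map (t ·ᵗ_) q *P r ≡ map (t ·ᵗ_) (q *P r)
  map-·ᵗ-*P t []      r = refl
  map-·ᵗ-*P t (u ∷ q) r = begin
    map ((t ·ᵗ u) ·ᵗ_) r ++ map (t ·ᵗ_) q *P r
      ≡⟨ cong₂ _++_ (ListP.map-cong (·ᵗ-assoc t u) r) (map-·ᵗ-*P t q r) ⟩
    map ((t ·ᵗ_) ∘ (u ·ᵗ_)) r ++ map (t ·ᵗ_) (q *P r)     ≡⟨ cong (_++ map (t ·ᵗ_) (q *P r)) (ListP.map-∘ r) ⟩
    map (t ·ᵗ_) (map (u ·ᵗ_) r) ++ map (t ·ᵗ_) (q *P r)   ≡⟨ ListP.map-++ (t ·ᵗ_) (map (u ·ᵗ_) r) (q *P r) ⟨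
    map (t ·ᵗ_) (map (u ·ᵗ_) r ++ q *P r)                 ∎
    where open ≡-Reasoning

  *-assoc : (p q r : Pol n) → (p *P q) *P r ≡ p *P (q *P r)
  *-assoc []      q r = refl
  *-assoc (t ∷ p) q r = trans (*-distribʳ-++ r (map (t ·ᵗ_) q) (p *P q))
                              (cong₂ _++_ (map-·ᵗ-*P t q r) (*-assoc p q r))

  *-zeroʳ : (p : Pol n) → p *P [] ≡ []
  *-zeroʳ []      = refl
  *-zeroʳ (t ∷ p) = *-zeroʳ p

  *-identityˡ : (p : Pol n) → 1P *P p ≡ p
  *-identityˡ p = trans (ListP.++-identityʳ _) (trans (ListP.map-cong 1·ᵗ p) (ListP.map-id p))
    where
    1·ᵗ : (u : Term n) → (1ℚ , Vec.replicate n 0) ·ᵗ u ≡ u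
    1·ᵗ (c , a) = cong₂ _,_ (ℚP.*-identityˡ c) (VecP.zipWith-identityˡ ℕP.+-identityˡ a)

  coeff-*P-∷ʳ : (q : Pol n) (t : Term n) (p : Pol n) (m : Mon n) →
    coeff (q *P (t ∷ p)) m ≡ coeff (map (_·ᵗ t) q) m ℚ.+ coeff (q *P p) m
  coeff-*P-∷ʳ []      t p m = sym (ℚP.+-identityˡ 0ℚ)
  coeff-*P-∷ʳ (u ∷ q) t p m = begin
    ut ℚ.+ coeff (map (u ·ᵗ_) p ++ q *P (t ∷ p)) m
      ≡⟨ cong (ut ℚ.+_) (trans (coeff-++ (map (u ·ᵗ_) p) _ m) (cong (up ℚ.+_) (coeff-*P-∷ʳ q t p m))) ⟩
    ut ℚ.+ (up ℚ.+ (qt ℚ.+ qp))  ≡⟨ ℚP.+-assoc ut up (qt ℚ.+ qp) ⟨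
    (ut ℚ.+ up) ℚ.+ (qt ℚ.+ qp)  ≡⟨ interchange ut up qt qp ⟩
    (ut ℚ.+ qt) ℚ.+ (up ℚ.+ qp)  ≡⟨ cong ((ut ℚ.+ qt) ℚ.+_) (coeff-++ (map (u ·ᵗ_) p) (q *P p) m) ⟨
    coeff (map (_·ᵗ t) (u ∷ q)) m ℚ.+ coeff ((u ∷ q) *P p) m ∎
    where
    open ≡-Reasoning
    open CommSemigroupProperties (CommutativeMonoid.commutativeSemigroup ℚP.+-0-commutativeMonoid) using (interchange)
    ut = termCoeff (u ·ᵗ t) m
    up = coeff (map (u ·ᵗ_) p) m
    qt = coeff (map (_·ᵗ t) q) m
    qp = coeff (q *P p) m

  *-comm : (p q : Pol n) → p *P q ≋ q *P p
  *-comm []      q = ≡⇒≋ (sym (*-zeroʳ q))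
  *-comm (t ∷ p) q = mk≋ λ m → begin
    coeff (map (t ·ᵗ_) q ++ p *P q) m               ≡⟨ coeff-++ (map (t ·ᵗ_) q) (p *P q) m ⟩
    coeff (map (t ·ᵗ_) q) m ℚ.+ coeff (p *P q) m
      ≡⟨ cong₂ (λ r s → coeff r m ℚ.+ s) (ListP.map-cong (·ᵗ-comm t) q) (coeff-≡ (*-comm p q) m) ⟩
    coeff (map (_·ᵗ t) q) m ℚ.+ coeff (q *P p) m    ≡⟨ coeff-*P-∷ʳ q t p m ⟨
    coeff (q *P (t ∷ p)) m                          ∎
    where open ≡-Reasoning

  *-cong : {p p′ q q′ : Pol n} → p ≋ p′ → q ≋ q′ → p *P q ≋ p′ *P q′
  *-cong {p} {p′} {q} {q′} p≋p′ q≋q′ = begin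
    p *P q    ≈⟨ *-congˡ p q≋q′ ⟩
    p *P q′   ≈⟨ *-comm p q′ ⟩
    q′ *P p   ≈⟨ *-congˡ q′ p≋p′ ⟩
    q′ *P p′  ≈⟨ *-comm q′ p′ ⟩
    p′ *P q′  ∎
    where open import Relation.Binary.Reasoning.Setoid (≋-setoid n)

Pol-commutativeSemiring : ℕ → CommutativeSemiring 0ℓ 0ℓ
Pol-commutativeSemiring n = record
  { Carrier               = Pol n
  ; _≈_                   = _≋_
  ; _+_                   = _+P_
  ; _*_                   = _*P_
  ; 0#                    = 0P
  ; 1#                    = 1P
  ; isCommutativeSemiring = isCommutativeSemiringˡ record
    { +-isCommutativeMonoid = record
      { isMonoid = record
        { isSemigroup = record
          { isMagma = record { isEquivalence = isEquivalence ; ∙-cong = ++-cong }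
          ; assoc   = λ p q r → reflexive (ListP.++-assoc p q r)
          }
        ; identity = (λ p → ≋-refl) , (λ p → reflexive (ListP.++-identityʳ p))
        }
      ; comm = ++-comm
      }
    ; *-isCommutativeMonoid = record
      { isMonoid = record
        { isSemigroup = record
          { isMagma = record { isEquivalence = isEquivalence ; ∙-cong = *-cong }
          ; assoc   = λ p q r → reflexive (*-assoc p q r)
          }
        ; identity = (λ p → reflexive (*-identityˡ p)) , (λ p → ≋-trans (*-comm p 1P) (reflexive (*-identityˡ p)))
        }
      ; comm = *-comm
      }
    ; distribʳ = λ p q r → reflexive (*-distribʳ-++ p q r)
    ; zeroˡ    = λ p → ≋-refl
    }
  }
  where open Setoid (≋-setoid n) using (isEquivalence; reflexive) renaming (refl to ≋-refl; trans to ≋-trans)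

module Poly {n : ℕ} = CommutativeSemiring (Pol-commutativeSemiring n)

infix 4 _⊆_
_⊆_ : {n : ℕ} → Subsp n → Subsp n → Set
V ⊆ W = ∀ p → V p → W p

⊆-antisym : {n : ℕ} {V W : Subsp n} → V ⊆ W → W ⊆ V → V ≐ W
⊆-antisym V⊆W W⊆V p = V⊆W p , W⊆V p

≐-trans : {n : ℕ} {U V W : Subsp n} → U ≐ V → V ≐ W → U ≐ W
≐-trans U≐V V≐W p = proj₁ (V≐W p) ∘ proj₁ (U≐V p) , proj₂ (U≐V p) ∘ proj₂ (V≐W p)

≐-sym : {n : ℕ} {V W : Subsp n} → V ≐ W → W ≐ V
≐-sym V≐W p = proj₂ (V≐W p) , proj₁ (V≐W p)

record IsAddSubmonoid {n : ℕ} (W : Subsp n) : Set where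
  field
    ∈-resp-≈P : {p q : Pol n} → p ≈P q → W p → W q
    0∈        : W 0P
    +∈        : {p q : Pol n} → W p → W q → W (p +P q)
open IsAddSubmonoid

module _ {n : ℕ} {A : Set} {V : A → Subsp n} where

  SumSp-least : {W : Subsp n} → IsAddSubmonoid W → (∀ a → V a ⊆ W) → SumSp V ⊆ W
  SumSp-least {W} W-sub V⊆W p (xs , Σxs≈p) = ∈-resp-≈P W-sub Σxs≈p (Σ∈ xs)
    where
    Σ∈ : (xs : List (Σ A λ a → Σ (Pol n) (V a))) → W (sumP (map (proj₁ ∘ proj₂) xs))
    Σ∈ []                     = 0∈ W-sub
    Σ∈ ((a , q , q∈Va) ∷ xs) = +∈ W-sub (V⊆W a q q∈Va) (Σ∈ xs)

  ⊆-SumSp : (a : A) → V a ⊆ SumSp V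
  ⊆-SumSp a p p∈Va = (a , p , p∈Va) ∷ [] , coeff-≡ (Poly.+-identityʳ p)

  SumSp-isAddSubmonoid : IsAddSubmonoid (SumSp V)
  SumSp-isAddSubmonoid = record
    { ∈-resp-≈P = λ { {p} {q} p≈q (xs , Σxs≈p) → xs , λ m → trans (Σxs≈p m) (p≈q m) }
    ; 0∈        = [] , λ m → refl
    ; +∈        = λ { {p} {q} (xs , Σxs≈p) (ys , Σys≈q) → xs ++ ys , coeff-≡ (begin
                    total (xs ++ ys)      ≡⟨ total-++ xs ys ⟩
                    total xs ++ total ys  ≈⟨ ++-cong {p = total xs} {p} {total ys} {q} (mk≋ Σxs≈p) (mk≋ Σys≈q) ⟩
                    p ++ q                ∎) }
    }
    where
    open import Relation.Binary.Reasoning.Setoid (≋-setoid n)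
    total : List (Σ A λ a → Σ (Pol n) (V a)) → Pol n
    total xs = sumP (map (proj₁ ∘ proj₂) xs)
    total-++ : (xs ys : List (Σ A λ a → Σ (Pol n) (V a))) → total (xs ++ ys) ≡ total xs ++ total ys
    total-++ xs ys = trans (cong sumP (ListP.map-++ (proj₁ ∘ proj₂) xs ys))
                           (sym (ListP.concat-++ (map (proj₁ ∘ proj₂) xs) (map (proj₁ ∘ proj₂) ys)))

SumSp-mono : {n : ℕ} {A B : Set} {V : A → Subsp n} {W : B → Subsp n} →
  (∀ a → ∃ λ b → V a ⊆ W b) → SumSp V ⊆ SumSp W
SumSp-mono V⊆W = SumSp-least SumSp-isAddSubmonoid λ a p p∈Va → ⊆-SumSp (proj₁ (V⊆W a)) p (proj₂ (V⊆W a) p p∈Va)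

module _ {n : ℕ} {g : Pol n} where

  mulSp-mono : {V W : Subsp n} → V ⊆ W → mulSp g V ⊆ mulSp g W
  mulSp-mono V⊆W p (v , v∈V , gv≈p) = v , V⊆W v v∈V , gv≈p

  mulSp-resp-≋ : {h : Pol n} {V : Subsp n} → g ≋ h → mulSp g V ⊆ mulSp h V
  mulSp-resp-≋ g≋h p (v , v∈V , gv≈p) =
    v , v∈V , λ m → trans (coeff-≡ (Poly.*-cong (Poly.sym g≋h) (Poly.refl {x = v})) m) (gv≈p m)

  mulSp-*P : {h : Pol n} {V : Subsp n} → mulSp (g *P h) V ≐ mulSp g (mulSp h V)
  mulSp-*P {h} p =
    (λ { (v , v∈V , ghv≈p) → h *P v , (v , v∈V , λ m → refl) ,
           λ m → trans (coeff-≡ (Poly.sym (Poly.*-assoc g h v)) m) (ghv≈p m) }) ,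
    (λ { (w , (v , v∈V , hv≈w) , gw≈p) → v , v∈V ,
           λ m → trans (coeff-≡ (Poly.*-assoc g h v) m)
                       (trans (coeff-≡ (*-congˡ g {h *P v} {w} (mk≋ hv≈w)) m) (gw≈p m)) })

  mulSp-isAddSubmonoid : {V : Subsp n} → IsAddSubmonoid V → IsAddSubmonoid (mulSp g V)
  mulSp-isAddSubmonoid V-sub = record
    { ∈-resp-≈P = λ { {p} {q} p≈q (v , v∈V , gv≈p) → v , v∈V , λ m → trans (gv≈p m) (p≈q m) }
    ; 0∈        = 0P , 0∈ V-sub , coeff-≡ (Poly.zeroʳ g)
    ; +∈        = λ { {p} {q} (v , v∈V , gv≈p) (w , w∈V , gw≈q) → v +P w , +∈ V-sub v∈V w∈V ,
                      λ m → trans (coeff-≡ (Poly.distribˡ g v w) m)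
                                  (coeff-≡ (++-cong {p = g *P v} {p} {g *P w} {q} (mk≋ gv≈p) (mk≋ gw≈q)) m) }
    }

  *P-preimage-isAddSubmonoid : {W : Subsp n} → IsAddSubmonoid W → IsAddSubmonoid (λ v → W (g *P v))
  *P-preimage-isAddSubmonoid W-sub = record
    { ∈-resp-≈P = λ {p} {q} p≈q → ∈-resp-≈P W-sub (coeff-≡ (*-congˡ g {p} {q} (mk≋ p≈q)))
    ; 0∈        = ∈-resp-≈P W-sub (coeff-≡ (Poly.sym (Poly.zeroʳ g))) (0∈ W-sub)
    ; +∈        = λ {p} {q} gp∈W gq∈W → ∈-resp-≈P W-sub (coeff-≡ (Poly.sym (Poly.distribˡ g p q))) (+∈ W-sub gp∈W gq∈W)
    }

  mulSp-SumSp : {A : Set} {V : A → Subsp n} → mulSp g (SumSp V) ≐ SumSp (λ a → mulSp g (V a))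
  mulSp-SumSp = ⊆-antisym
    (λ { p (v , v∈ΣV , gv≈p) → ∈-resp-≈P SumSp-isAddSubmonoid {g *P v} {p} gv≈p
           (SumSp-least (*P-preimage-isAddSubmonoid SumSp-isAddSubmonoid)
                        (λ a q q∈Va → ⊆-SumSp a (g *P q) (q , q∈Va , λ m → refl)) v v∈ΣV) })
    (SumSp-least (mulSp-isAddSubmonoid SumSp-isAddSubmonoid) (λ a → mulSp-mono (⊆-SumSp a)))

module _ {n : ℕ} {U₁ U₂ : Subsp n} (U₁-sub : IsAddSubmonoid U₁) (U₂-sub : IsAddSubmonoid U₂) where

  ⊕-isAddSubmonoid : IsAddSubmonoid (U₁ ⊕ U₂)
  ⊕-isAddSubmonoid = record
    { ∈-resp-≈P = λ { {p} {q} p≈q (u₁ , u₂ , u₁∈ , u₂∈ , u≈p) → u₁ , u₂ , u₁∈ , u₂∈ , λ m → trans (u≈p m) (p≈q m) }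
    ; 0∈        = 0P , 0P , 0∈ U₁-sub , 0∈ U₂-sub , λ m → refl
    ; +∈        = λ { {p} {q} (u₁ , u₂ , u₁∈ , u₂∈ , u≈p) (u₁′ , u₂′ , u₁′∈ , u₂′∈ , u′≈q) →
                      u₁ +P u₁′ , u₂ +P u₂′ , +∈ U₁-sub u₁∈ u₁′∈ , +∈ U₂-sub u₂∈ u₂′∈ ,
                      λ m → trans (coeff-≡ (Poly-+.interchange u₁ u₁′ u₂ u₂′) m)
                                  (coeff-≡ (++-cong {p = u₁ +P u₂} {p} {u₁′ +P u₂′} {q} (mk≋ u≈p) (mk≋ u′≈q)) m) }
    }
    where module Poly-+ = CommSemigroupProperties (Poly.+-commutativeSemigroup {n})

  SumSp-split : {A : Set} {V : A → Subsp n} → (∀ a → V a ⊆ U₁ ⊎ V a ⊆ U₂) →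
    U₁ ⊆ SumSp V → U₂ ⊆ SumSp V → SumSp V ≐ U₁ ⊕ U₂
  SumSp-split V⊆U₁∨U₂ U₁⊆ΣV U₂⊆ΣV = ⊆-antisym
    (SumSp-least ⊕-isAddSubmonoid (λ a → into-⊕ (V⊆U₁∨U₂ a)))
    (λ { p (u₁ , u₂ , u₁∈ , u₂∈ , u≈p) →
           ∈-resp-≈P SumSp-isAddSubmonoid {u₁ +P u₂} {p} u≈p
                     (+∈ SumSp-isAddSubmonoid {u₁} {u₂} (U₁⊆ΣV u₁ u₁∈) (U₂⊆ΣV u₂ u₂∈)) })
    where
    into-⊕ : {W : Subsp n} → W ⊆ U₁ ⊎ W ⊆ U₂ → W ⊆ U₁ ⊕ U₂
    into-⊕ (inj₁ W⊆U₁) p p∈W = p , 0P , W⊆U₁ p p∈W , 0∈ U₂-sub , coeff-≡ (Poly.+-identityʳ p)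
    into-⊕ (inj₂ W⊆U₂) p p∈W = 0P , p , 0∈ U₁-sub , W⊆U₂ p p∈W , λ m → refl

module _ {A : Set} where

  countᵇ-∷ : (P : A → Bool) (x : A) (xs : List A) → countᵇ P (x ∷ xs) ≡ (if P x then 1 else 0) ℕ.+ countᵇ P xs
  countᵇ-∷ P x xs with P x
  ... | true  = refl
  ... | false = refl

  filterᵇ-cong : {P Q : A → Bool} → (∀ x → P x ≡ Q x) → (xs : List A) → filterᵇ P xs ≡ filterᵇ Q xs
  filterᵇ-cong P≗Q []                  = refl
  filterᵇ-cong {Q = Q} P≗Q (x ∷ xs) rewrite P≗Q x with Q x
  ... | true  = cong (x ∷_) (filterᵇ-cong P≗Q xs)
  ... | false = filterᵇ-cong P≗Q xs

  countᵇ-cong : {P Q : A → Bool} → (∀ x → P x ≡ Q x) → (xs : List A) → countᵇ P xs ≡ countᵇ Q xs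
  countᵇ-cong P≗Q xs = cong length (filterᵇ-cong P≗Q xs)

mult-∷-≡ : {v x : ℕ} (xs : List ℕ) → v ≡ x → mult v (x ∷ xs) ≡ suc (mult v xs)
mult-∷-≡ {v} {x} xs v≡x =
  trans (countᵇ-∷ (v ≡ᵇ_) x xs) (cong (λ b → (if b then 1 else 0) ℕ.+ mult v xs) (dec-true (v ℕ.≟ x) v≡x))

mult-∷-≢ : {v x : ℕ} (xs : List ℕ) → v ≢ x → mult v (x ∷ xs) ≡ mult v xs
mult-∷-≢ {v} {x} xs v≢x =
  trans (countᵇ-∷ (v ≡ᵇ_) x xs) (cong (λ b → (if b then 1 else 0) ℕ.+ mult v xs) (dec-false (v ℕ.≟ x) v≢x))

module _ {P Q : ℕ → Bool} {ℓ : ℕ} (P≗Q : ∀ v → v ≢ ℓ → P v ≡ Q v) (Pℓ : P ℓ ≡ true) (Qℓ : Q ℓ ≡ false) where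

  countᵇ-flip : (xs : List ℕ) → countᵇ P xs ≡ mult ℓ xs ℕ.+ countᵇ Q xs
  countᵇ-flip []       = refl
  countᵇ-flip (x ∷ xs) with ℓ ℕ.≟ x
  ... | yes refl rewrite countᵇ-∷ P ℓ xs | countᵇ-∷ Q ℓ xs | Pℓ | Qℓ | mult-∷-≡ xs (refl {x = ℓ}) =
    cong suc (countᵇ-flip xs)
  ... | no ℓ≢x rewrite countᵇ-∷ P x xs | countᵇ-∷ Q x xs | P≗Q x (ℓ≢x ∘ sym) | mult-∷-≢ xs ℓ≢x =
    trans (cong ((if Q x then 1 else 0) ℕ.+_) (countᵇ-flip xs))
          (x∙yz≈y∙xz (if Q x then 1 else 0) (mult ℓ xs) (countᵇ Q xs))
    where open CommSemigroupProperties ℕP.+-commutativeSemigroup using (x∙yz≈y∙xz)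

mult-applyUpTo-below : {v : ℕ} (f : ℕ → ℕ) (c : ℕ) → (∀ i → f i ≡ i ℕ.+ c) → v < c →
  ∀ k → mult v (applyUpTo f k) ≡ 0
mult-applyUpTo-below f c f≡ v<c zero    = refl
mult-applyUpTo-below f c f≡ v<c (suc k) =
  trans (mult-∷-≢ _ (λ v≡f0 → ℕP.<-irrefl (trans v≡f0 (f≡ 0)) v<c))
        (mult-applyUpTo-below (f ∘ suc) (suc c) (λ i → trans (f≡ (suc i)) (sym (ℕP.+-suc i c))) (ℕP.m<n⇒m<1+n v<c) k)

mult-applyUpTo : {v : ℕ} (f : ℕ → ℕ) (c : ℕ) → (∀ i → f i ≡ i ℕ.+ c) → c ≤ v →
  ∀ k → v < k ℕ.+ c → mult v (applyUpTo f k) ≡ 1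
mult-applyUpTo f c f≡ c≤v zero    v<c   = contradiction v<c (ℕP.≤⇒≯ c≤v)
mult-applyUpTo {v} f c f≡ c≤v (suc k) v<k+c with v ℕ.≟ f 0
... | yes v≡f0 = trans (mult-∷-≡ _ v≡f0)
  (cong suc (mult-applyUpTo-below (f ∘ suc) (suc c) (λ i → trans (f≡ (suc i)) (sym (ℕP.+-suc i c)))
                                  (ℕP.≤-reflexive (cong suc (trans v≡f0 (f≡ 0)))) k))
... | no v≢f0 = trans (mult-∷-≢ _ v≢f0)
  (mult-applyUpTo (f ∘ suc) (suc c) (λ i → trans (f≡ (suc i)) (sym (ℕP.+-suc i c)))
                  (ℕP.≤∧≢⇒< c≤v (λ c≡v → v≢f0 (trans (sym c≡v) (sym (f≡ 0)))))
                  k (subst (v <_) (sym (ℕP.+-suc k c)) v<k+c))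

mult-range : {a b v : ℕ} → a ≤ v → v ≤ b → mult v (range a b) ≡ 1
mult-range {a} {b} {v} a≤v v≤b =
  trans (cong (mult v) (ListP.map-applyUpTo (λ i → i) (ℕ._+ a) (suc b ∸ a)))
        (mult-applyUpTo (ℕ._+ a) a (λ i → refl) a≤v (suc b ∸ a) v<suc[b∸a]+a)
  where
  v<suc[b∸a]+a : v < (suc b ∸ a) ℕ.+ a
  v<suc[b∸a]+a = subst (v <_) (sym (ℕP.m∸n+n≡m (ℕP.m≤n⇒m≤1+n (ℕP.≤-trans a≤v v≤b)))) (ℕ.s≤s v≤b)


∧-≡-true : {a b : Bool} → a ∧ b ≡ true → a ≡ true × b ≡ true
∧-≡-true {true} {true} _ = refl , refl

∧-false : (a : Bool) {b : Bool} → b ≡ false → a ∧ b ≡ false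
∧-false a b≡false = trans (cong (a ∧_) b≡false) (BoolP.∧-zeroʳ a)

interiorᵇ : ℕ → ℕ → Bool
interiorᵇ n v = (1 ≤ᵇ v) ∧ (v <ᵇ n)

module _ {n : ℕ} where

  hatᵇ-interior : (J : List ℕ) (v : ℕ) → hatᵇ n J v ≡ interiorᵇ n v ∧ (1 ≤ᵇ mult v J)
  hatᵇ-interior J v = sym (BoolP.∧-assoc (1 ≤ᵇ v) (v <ᵇ n) (1 ≤ᵇ mult v J))

  hatᵇ⇒interior : {J : List ℕ} {v : ℕ} → hatᵇ n J v ≡ true → interiorᵇ n v ≡ true
  hatᵇ⇒interior {J} {v} v∈Ĵ = proj₁ (∧-≡-true {interiorᵇ n v} (trans (sym (hatᵇ-interior J v)) v∈Ĵ))

  hatᵇ⇒mult : {J : List ℕ} {v : ℕ} → hatᵇ n J v ≡ true → 1 ≤ mult v J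
  hatᵇ⇒mult {J} {v} v∈Ĵ =
    ℕP.≤ᵇ⇒≤ 1 (mult v J)
      (Equivalence.from BoolP.T-≡ (proj₂ (∧-≡-true {interiorᵇ n v} (trans (sym (hatᵇ-interior J v)) v∈Ĵ))))

  hatᵇ-∷-≢ : {ℓ v : ℕ} (I : List ℕ) → v ≢ ℓ → hatᵇ n (ℓ ∷ I) v ≡ hatᵇ n I v
  hatᵇ-∷-≢ {ℓ} {v} I v≢ℓ = cong (λ k → (1 ≤ᵇ v) ∧ (v <ᵇ n) ∧ (1 ≤ᵇ k)) (mult-∷-≢ I v≢ℓ)

  hatᵇ-∷-self : (ℓ : ℕ) (I : List ℕ) → hatᵇ n (ℓ ∷ I) ℓ ≡ interiorᵇ n ℓ
  hatᵇ-∷-self ℓ I = trans (cong (λ k → (1 ≤ᵇ ℓ) ∧ (ℓ <ᵇ n) ∧ (1 ≤ᵇ k)) (mult-∷-≡ {ℓ} I refl))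
                          (cong ((1 ≤ᵇ ℓ) ∧_) (BoolP.∧-identityʳ (ℓ <ᵇ n)))

  interiorᵇ-boundary : {v : ℕ} → v ≡ 0 ⊎ v ≡ n → interiorᵇ n v ≡ false
  interiorᵇ-boundary (inj₁ refl) = refl
  interiorᵇ-boundary (inj₂ refl) = ∧-false (1 ≤ᵇ n) (dec-false (n ℕ.<? n) (ℕP.n≮n n))

  hatᵇ-∷-unchanged : {ℓ : ℕ} {I : List ℕ} → hatᵇ n I ℓ ≡ true ⊎ ℓ ≡ 0 ⊎ ℓ ≡ n →
    ∀ v → hatᵇ n (ℓ ∷ I) v ≡ hatᵇ n I v
  hatᵇ-∷-unchanged {ℓ} {I} case v with v ℕ.≟ ℓ
  ... | no v≢ℓ   = hatᵇ-∷-≢ I v≢ℓ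
  ... | yes refl = trans (hatᵇ-∷-self ℓ I) (trans (interior≡ case) (sym (hatᵇ-interior I ℓ)))
    where
    interior≡ : hatᵇ n I ℓ ≡ true ⊎ ℓ ≡ 0 ⊎ ℓ ≡ n → interiorᵇ n ℓ ≡ interiorᵇ n ℓ ∧ (1 ≤ᵇ mult ℓ I)
    interior≡ (inj₁ ℓ∈Î)     = trans (hatᵇ⇒interior {I} ℓ∈Î) (trans (sym ℓ∈Î) (hatᵇ-interior I ℓ))
    interior≡ (inj₂ boundary) rewrite interiorᵇ-boundary boundary = refl

hatᵇ-∷-mono : {n ℓ v : ℕ} (I : List ℕ) → hatᵇ n I v ≡ true → hatᵇ n (ℓ ∷ I) v ≡ true
hatᵇ-∷-mono {n} {ℓ} {v} I v∈Î with v ℕ.≟ ℓ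
... | no v≢ℓ   = trans (hatᵇ-∷-≢ {n} I v≢ℓ) v∈Î
... | yes refl = trans (hatᵇ-∷-self {n} v I) (hatᵇ⇒interior {n} {I} {v} v∈Î)

gapBelowᵇ hatAboveᵇ : ℕ → List ℕ → ℕ → ℕ → Bool
gapBelowᵇ  n J i j = not (hatᵇ n J j) ∧ (j <ᵇ i)
hatAboveᵇ n J i j = (hatᵇ n J j ∨ (j ≡ᵇ n)) ∧ (i <ᵇ j)

module _ {n : ℕ} {J K : List ℕ} (Ĵ≗K̂ : ∀ v → hatᵇ n J v ≡ hatᵇ n K v) where

  khat-cong : khat n J ≡ khat n K
  khat-cong = cong suc (countᵇ-cong Ĵ≗K̂ (range 1 (n ∸ 1)))

  rA-cong : ∀ i → rA n J i ≡ rA n K i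
  rA-cong i = cong +_ (countᵇ-cong (λ j → cong (λ b → not b ∧ (j <ᵇ i)) (Ĵ≗K̂ j)) (range 1 (n ∸ 1)))

  rB-cong : ∀ i → rB n J i ≡ rB n K i
  rB-cong i = cong₂ (λ k c → (+ n - + k) ℤ.+ + c) khat-cong
                    (countᵇ-cong (λ j → cong (λ b → (b ∨ (j ≡ᵇ n)) ∧ (i <ᵇ j)) (Ĵ≗K̂ j)) (range 1 n))

module _ {n ℓ : ℕ} (I : List ℕ) (i : ℕ) {j : ℕ} (j≢ℓ : j ≢ ℓ) where

  gapBelowᵇ-∷-≢ : gapBelowᵇ n (ℓ ∷ I) i j ≡ gapBelowᵇ n I i j
  gapBelowᵇ-∷-≢ = cong (λ b → not b ∧ (j <ᵇ i)) (hatᵇ-∷-≢ {n} I j≢ℓ)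

  hatAboveᵇ-∷-≢ : hatAboveᵇ n (ℓ ∷ I) i j ≡ hatAboveᵇ n I i j
  hatAboveᵇ-∷-≢ = cong (λ b → (b ∨ (j ≡ᵇ n)) ∧ (i <ᵇ j)) (hatᵇ-∷-≢ {n} I j≢ℓ)

shiftAbove : ℕ → ℕ → ℤ → ℤ
shiftAbove ℓ i r = if ℓ <ᵇ i then r - + 1 else r

module NewInterior {n ℓ : ℕ} {I : List ℕ} (1≤ℓ : 1 ≤ ℓ) (ℓ<n : ℓ < n) (ℓ∉Î : hatᵇ n I ℓ ≡ false) where

  interior-ℓ : interiorᵇ n ℓ ≡ true
  interior-ℓ = cong₂ _∧_ (dec-true (1 ℕ.≤? ℓ) 1≤ℓ) (dec-true (ℓ ℕ.<? n) ℓ<n)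

  ℓ∈Ĩ : hatᵇ n (ℓ ∷ I) ℓ ≡ true
  ℓ∈Ĩ = trans (hatᵇ-∷-self {n} ℓ I) interior-ℓ

  mult-ℓ-I : mult ℓ I ≡ 0
  mult-ℓ-I = ℕP.n<1⇒n≡0 (ℕP.≰⇒> λ 1≤mult → contradiction
    (trans (sym ℓ∉Î) (trans (hatᵇ-interior {n} I ℓ) (cong₂ _∧_ interior-ℓ (dec-true (1 ℕ.≤? mult ℓ I) 1≤mult)))) λ ())

  mult-ℓ-interior : mult ℓ (range 1 (n ∸ 1)) ≡ 1
  mult-ℓ-interior = mult-range 1≤ℓ (ℓ≤n∸1 ℓ<n)
    where
    ℓ≤n∸1 : {m : ℕ} → ℓ < m → ℓ ≤ m ∸ 1
    ℓ≤n∸1 (ℕ.s≤s ℓ≤m) = ℓ≤m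

  khat-∷ : khat n (ℓ ∷ I) ≡ suc (khat n I)
  khat-∷ = cong suc (trans (countᵇ-flip {hatᵇ n (ℓ ∷ I)} {hatᵇ n I} (λ v → hatᵇ-∷-≢ {n} I) ℓ∈Ĩ ℓ∉Î (range 1 (n ∸ 1)))
                           (cong (ℕ._+ countᵇ (hatᵇ n I) (range 1 (n ∸ 1))) mult-ℓ-interior))

  rA-∷ : ∀ v → rA n (ℓ ∷ I) v ≡ shiftAbove ℓ v (rA n I v)
  rA-∷ v with ℓ <ᵇ v in ℓ<ᵇv
  ... | true  = sym (cong (λ c → + c - + 1) (trans
                  (countᵇ-flip {gapBelowᵇ n I v} {gapBelowᵇ n (ℓ ∷ I) v} (λ j j≢ℓ → sym (gapBelowᵇ-∷-≢ {n} I v j≢ℓ))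
                               ℓ-gap-Î ℓ-not-gap-Ĩ (range 1 (n ∸ 1)))
                  (cong (ℕ._+ countᵇ (gapBelowᵇ n (ℓ ∷ I) v) (range 1 (n ∸ 1))) mult-ℓ-interior)))
    where
    ℓ-gap-Î : gapBelowᵇ n I v ℓ ≡ true
    ℓ-gap-Î = cong₂ (λ a b → not a ∧ b) ℓ∉Î ℓ<ᵇv
    ℓ-not-gap-Ĩ : gapBelowᵇ n (ℓ ∷ I) v ℓ ≡ false
    ℓ-not-gap-Ĩ = cong (λ a → not a ∧ (ℓ <ᵇ v)) ℓ∈Ĩ
  ... | false = cong +_ (countᵇ-cong gap≗ (range 1 (n ∸ 1)))
    where
    gap≗ : ∀ j → gapBelowᵇ n (ℓ ∷ I) v j ≡ gapBelowᵇ n I v j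
    gap≗ j with j ℕ.≟ ℓ
    ... | no j≢ℓ   = gapBelowᵇ-∷-≢ {n} I v j≢ℓ
    ... | yes refl = trans (cong (λ a → not a ∧ (ℓ <ᵇ v)) ℓ∈Ĩ) (sym (cong₂ (λ a b → not a ∧ b) ℓ∉Î ℓ<ᵇv))

  rB-∷ : ∀ v → v ≢ ℓ → rB n (ℓ ∷ I) v ≡ shiftAbove ℓ v (rB n I v)
  rB-∷ v v≢ℓ with ℓ <ᵇ v in ℓ<ᵇv
  ... | true  = trans (cong₂ (λ k c → (+ n - + k) ℤ.+ + c) khat-∷ (countᵇ-cong above≗ (range 1 n)))
                      (fewer-above (+ n) (+ khat n I) (+ countᵇ (hatAboveᵇ n I v) (range 1 n)))
    where
    fewer-above : ∀ (N K C : ℤ) → (N - (+ 1 ℤ.+ K)) ℤ.+ C ≡ ((N - K) ℤ.+ C) - + 1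
    fewer-above = solve-∀
    v<ᵇℓ : (v <ᵇ ℓ) ≡ false
    v<ᵇℓ = dec-false (v ℕ.<? ℓ) (ℕP.<⇒≯ (ℕP.<ᵇ⇒< ℓ v (Equivalence.from BoolP.T-≡ ℓ<ᵇv)))
    above≗ : ∀ j → hatAboveᵇ n (ℓ ∷ I) v j ≡ hatAboveᵇ n I v j
    above≗ j with j ℕ.≟ ℓ
    ... | no j≢ℓ   = hatAboveᵇ-∷-≢ {n} I v j≢ℓ
    ... | yes refl = trans (∧-false (hatᵇ n (ℓ ∷ I) ℓ ∨ (ℓ ≡ᵇ n)) v<ᵇℓ) (sym (∧-false (hatᵇ n I ℓ ∨ (ℓ ≡ᵇ n)) v<ᵇℓ))
  ... | false = trans (cong₂ (λ k c → (+ n - + k) ℤ.+ + c) khat-∷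
                             (trans (countᵇ-flip {hatAboveᵇ n (ℓ ∷ I) v} {hatAboveᵇ n I v} (λ j → hatAboveᵇ-∷-≢ {n} I v)
                                                 ℓ-above-Ĩ ℓ-above-Î (range 1 n))
                                    (cong (ℕ._+ countᵇ (hatAboveᵇ n I v) (range 1 n)) (mult-range 1≤ℓ (ℕP.<⇒≤ ℓ<n)))))
                      (one-more-above (+ n) (+ khat n I) (+ countᵇ (hatAboveᵇ n I v) (range 1 n)))
    where
    one-more-above : ∀ (N K C : ℤ) → (N - (+ 1 ℤ.+ K)) ℤ.+ (+ 1 ℤ.+ C) ≡ (N - K) ℤ.+ C
    one-more-above = solve-∀
    v<ᵇℓ : (v <ᵇ ℓ) ≡ true
    v<ᵇℓ = dec-true (v ℕ.<? ℓ)
      (ℕP.≤∧≢⇒< (ℕP.≮⇒≥ λ ℓ<v → contradiction (trans (sym (dec-true (ℓ ℕ.<? v) ℓ<v)) ℓ<ᵇv) λ ()) v≢ℓ)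
    ℓ-above-Ĩ : hatAboveᵇ n (ℓ ∷ I) v ℓ ≡ true
    ℓ-above-Ĩ = cong₂ (λ a b → (a ∨ (ℓ ≡ᵇ n)) ∧ b) ℓ∈Ĩ v<ᵇℓ
    ℓ-above-Î : hatAboveᵇ n I v ℓ ≡ false
    ℓ-above-Î = trans (cong₂ (λ a b → (a ∨ (ℓ ≡ᵇ n)) ∧ b) ℓ∉Î v<ᵇℓ)
                      (trans (BoolP.∧-identityʳ (ℓ ≡ᵇ n)) (dec-false (ℓ ℕ.≟ n) (ℕP.<⇒≢ ℓ<n)))

map-cong-away : {B : Set} {F G : ℕ → B} {ℓ : ℕ} → (∀ v → v ≢ ℓ → F v ≡ G v) →
  (xs : List ℕ) → mult ℓ xs ≡ 0 → map F xs ≡ map G xs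
map-cong-away F≗G []       _      = refl
map-cong-away {ℓ = ℓ} F≗G (x ∷ xs) mult≡0 with ℓ ℕ.≟ x
... | yes ℓ≡x = contradiction (trans (sym (mult-∷-≡ xs ℓ≡x)) mult≡0) ℕP.1+n≢0
... | no  ℓ≢x = cong₂ _∷_ (F≗G x (ℓ≢x ∘ sym)) (map-cong-away F≗G xs (trans (sym (mult-∷-≢ xs ℓ≢x)) mult≡0))

module _ {n : ℕ} where
  open import Relation.Binary.Reasoning.Setoid (≋-setoid n)
  open CommSemigroupProperties (Poly.*-commutativeSemigroup {n}) using (x∙yz≈y∙xz)

  prodP-filterᵇ : {A : Set} (F : A → Pol n) (P : A → Bool) (xs : List A) →
    prodP (map F (filterᵇ P xs)) ≋ prodP (map (λ v → if P v then F v else 1P) xs)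
  prodP-filterᵇ F P []       = Poly.refl
  prodP-filterᵇ F P (x ∷ xs) with P x
  ... | true  = *-congˡ (F x) (prodP-filterᵇ F P xs)
  ... | false = Poly.trans (prodP-filterᵇ F P xs)
                           (Poly.reflexive (sym (*-identityˡ (prodP (map (λ v → if P v then F v else 1P) xs)))))

  prodP-map-focus : {F G : ℕ → Pol n} {ℓ : ℕ} (g : Pol n) → (∀ v → v ≢ ℓ → F v ≡ G v) → F ℓ ≋ g *P G ℓ →
    (xs : List ℕ) → mult ℓ xs ≡ 1 → prodP (map F xs) ≋ g *P prodP (map G xs)
  prodP-map-focus {F} {G} {ℓ} g F≗G Fℓ≋gGℓ (x ∷ xs) mult≡1 with ℓ ℕ.≟ x
  ... | yes refl = begin
    F ℓ *P prodP (map F xs)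
      ≈⟨ Poly.*-cong Fℓ≋gGℓ (Poly.reflexive (cong prodP (map-cong-away F≗G xs mult-xs≡0))) ⟩
    (g *P G ℓ) *P prodP (map G xs)  ≈⟨ Poly.*-assoc g (G ℓ) (prodP (map G xs)) ⟩
    g *P (G ℓ *P prodP (map G xs))  ∎
    where
    mult-xs≡0 : mult ℓ xs ≡ 0
    mult-xs≡0 = ℕP.suc-injective (trans (sym (mult-∷-≡ {ℓ} xs refl)) mult≡1)
  ... | no ℓ≢x = begin
    F x *P prodP (map F xs)
      ≈⟨ Poly.*-cong (Poly.reflexive (F≗G x (ℓ≢x ∘ sym)))
                     (prodP-map-focus g F≗G Fℓ≋gGℓ xs (trans (sym (mult-∷-≢ xs ℓ≢x)) mult≡1)) ⟩
    G x *P (g *P prodP (map G xs))  ≈⟨ x∙yz≈y∙xz (G x) g (prodP (map G xs)) ⟩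
    g *P (G x *P prodP (map G xs))  ∎

bit : Bool → ℕ
bit b = if b then 1 else 0

suc-∸-bit : (m : ℕ) (b : Bool) → (b ≡ true → 1 ≤ m) → suc m ∸ bit b ≡ suc (m ∸ bit b)
suc-∸-bit m       false _   = refl
suc-∸-bit (suc m) true  _   = refl
suc-∸-bit zero    true  1≤0 with () ← 1≤0 refl

prodH-∷ : {n ℓ : ℕ} (I : List ℕ) (D : ℕ → Bool) → ℓ ≤ n → (D ℓ ≡ true → 1 ≤ mult ℓ I) →
  prodH n (ℓ ∷ I) D ≋ e ℓ *P prodH n I D
prodH-∷ {n} {ℓ} I D ℓ≤n ℓ∈D⇒ℓ∈I = prodP-map-focus {F = factor (ℓ ∷ I)} {G = factor I} {ℓ = ℓ} (e ℓ)
  (λ v v≢ℓ → cong (λ m → powP (e v) (m ∸ bit (D v))) (mult-∷-≢ I v≢ℓ))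
  (Poly.reflexive (cong (powP (e ℓ))
    (trans (cong (_∸ bit (D ℓ)) (mult-∷-≡ {ℓ} I refl)) (suc-∸-bit (mult ℓ I) (D ℓ) ℓ∈D⇒ℓ∈I))))
  (range 0 n) (mult-range ℕ.z≤n ℓ≤n)
  where
  factor : List ℕ → ℕ → Pol n
  factor J v = powP (e v) (mult v J ∸ bit (D v))

-- prodR n J D f is definitionally prodR-Î∖D n J D f *P prodR-I∖Î n J f.
prodR-Î∖D : (n : ℕ) → List ℕ → (ℕ → Bool) → (ℕ → ℤ → ℤ) → Pol n
prodR-Î∖D n J D f = prodP (map (λ i → eZ (f i (rA n J i))) (filterᵇ (λ i → hatᵇ n J i ∧ not (D i)) (range 1 (n ∸ 1))))

prodR-I∖Î : (n : ℕ) → List ℕ → (ℕ → ℤ → ℤ) → Pol n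
prodR-I∖Î n J f = prodP (map (λ v → powP (eZ (f v (rB n J v))) (mult v J ∸ bit (hatᵇ n J v))) (range 0 n))

prodR-∷-unchanged : {n ℓ : ℕ} {I : List ℕ} (D : ℕ → Bool) (f : ℕ → ℤ → ℤ) → ℓ ≤ n →
  (∀ v → hatᵇ n (ℓ ∷ I) v ≡ hatᵇ n I v) → prodR n (ℓ ∷ I) D f ≋ eZ (f ℓ (rB n I ℓ)) *P prodR n I D f
prodR-∷-unchanged {n} {ℓ} {I} D f ℓ≤n Ĩ≗Î = begin
  prodR-Î∖D n (ℓ ∷ I) D f *P prodR-I∖Î n (ℓ ∷ I) f  ≈⟨ Poly.*-cong (Poly.reflexive Î∖D-same) I∖Î-grows ⟩
  prodR-Î∖D n I D f *P (g *P prodR-I∖Î n I f)        ≈⟨ x∙yz≈y∙xz (prodR-Î∖D n I D f) g (prodR-I∖Î n I f) ⟩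
  g *P (prodR-Î∖D n I D f *P prodR-I∖Î n I f)        ∎
  where
  open import Relation.Binary.Reasoning.Setoid (≋-setoid n)
  open CommSemigroupProperties (Poly.*-commutativeSemigroup {n}) using (x∙yz≈y∙xz)
  g : Pol n
  g = eZ (f ℓ (rB n I ℓ))
  Î∖D-same : prodR-Î∖D n (ℓ ∷ I) D f ≡ prodR-Î∖D n I D f
  Î∖D-same = cong prodP (trans (cong (map _) (filterᵇ-cong (λ v → cong (_∧ not (D v)) (Ĩ≗Î v)) (range 1 (n ∸ 1))))
                               (ListP.map-cong (λ i → cong (λ r → eZ (f i r)) (rA-cong {n} {ℓ ∷ I} {I} Ĩ≗Î i)) _))
  I∖Î-grows : prodR-I∖Î n (ℓ ∷ I) f ≋ g *P prodR-I∖Î n I f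
  I∖Î-grows = prodP-map-focus {F = factor (ℓ ∷ I)} {G = factor I} {ℓ = ℓ} g
    (λ v v≢ℓ → cong₂ (λ r k → powP (eZ (f v r)) k) (rB-cong {n} {ℓ ∷ I} {I} Ĩ≗Î v)
                     (cong₂ (λ m b → m ∸ bit b) (mult-∷-≢ I v≢ℓ) (Ĩ≗Î v)))
    (Poly.reflexive (cong₂ (λ r k → powP (eZ (f ℓ r)) k) (rB-cong {n} {ℓ ∷ I} {I} Ĩ≗Î ℓ)
      (trans (cong₂ (λ m b → m ∸ bit b) (mult-∷-≡ {ℓ} I refl) (Ĩ≗Î ℓ))
             (suc-∸-bit (mult ℓ I) (hatᵇ n I ℓ) (hatᵇ⇒mult {n} {I} {ℓ})))))
    (range 0 n) (mult-range ℕ.z≤n ℓ≤n)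
    where
    factor : List ℕ → ℕ → Pol n
    factor J v = powP (eZ (f v (rB n J v))) (mult v J ∸ bit (hatᵇ n J v))

prodR-∷-new : {n ℓ : ℕ} {I : List ℕ} (D : ℕ → Bool) → 1 ≤ ℓ → ℓ < n → hatᵇ n I ℓ ≡ false → D ℓ ≡ false →
  prodR n (ℓ ∷ I) D (λ _ r → r) ≋ eZ (rA n I ℓ) *P prodR n I D (shiftAbove ℓ)
prodR-∷-new {n} {ℓ} {I} D 1≤ℓ ℓ<n ℓ∉Î ℓ∉D = begin
  prodR-Î∖D n (ℓ ∷ I) D (λ _ r → r) *P prodR-I∖Î n (ℓ ∷ I) (λ _ r → r)
    ≈⟨ Poly.*-cong Î∖D-grows (Poly.reflexive I∖Î-same) ⟩
  (g *P prodR-Î∖D n I D (shiftAbove ℓ)) *P prodR-I∖Î n I (shiftAbove ℓ)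
    ≈⟨ Poly.*-assoc g (prodR-Î∖D n I D (shiftAbove ℓ)) (prodR-I∖Î n I (shiftAbove ℓ)) ⟩
  g *P prodR n I D (shiftAbove ℓ) ∎
  where
  open import Relation.Binary.Reasoning.Setoid (≋-setoid n)
  open NewInterior {n} {ℓ} {I} 1≤ℓ ℓ<n ℓ∉Î
  g : Pol n
  g = eZ (rA n I ℓ)

  hatFactor : List ℕ → (ℕ → ℤ → ℤ) → ℕ → Pol n
  hatFactor J f i = if hatᵇ n J i ∧ not (D i) then eZ (f i (rA n J i)) else 1P

  hatFactor-ℓ : hatFactor (ℓ ∷ I) (λ _ r → r) ℓ ≋ g *P hatFactor I (shiftAbove ℓ) ℓ
  hatFactor-ℓ = begin
    hatFactor (ℓ ∷ I) (λ _ r → r) ℓ    ≡⟨ cong₂ (λ b d → if b ∧ not d then eZ (rA n (ℓ ∷ I) ℓ) else 1P) ℓ∈Ĩ ℓ∉D ⟩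
    eZ (rA n (ℓ ∷ I) ℓ)                 ≡⟨ cong eZ (trans (rA-∷ ℓ) (cong (λ b → if b then rA n I ℓ - + 1 else rA n I ℓ)
                                                                   (dec-false (ℓ ℕ.<? ℓ) (ℕP.n≮n ℓ)))) ⟩
    g                                   ≈⟨ Poly.*-identityʳ g ⟨
    g *P 1P
      ≡⟨ cong (λ b → g *P (if b ∧ not (D ℓ) then eZ (shiftAbove ℓ ℓ (rA n I ℓ)) else 1P)) ℓ∉Î ⟨
    g *P hatFactor I (shiftAbove ℓ) ℓ ∎

  Î∖D-grows : prodR-Î∖D n (ℓ ∷ I) D (λ _ r → r) ≋ g *P prodR-Î∖D n I D (shiftAbove ℓ)
  Î∖D-grows = begin
    prodR-Î∖D n (ℓ ∷ I) D (λ _ r → r)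
      ≈⟨ prodP-filterᵇ (λ i → eZ (rA n (ℓ ∷ I) i)) (λ i → hatᵇ n (ℓ ∷ I) i ∧ not (D i)) (range 1 (n ∸ 1)) ⟩
    prodP (map (hatFactor (ℓ ∷ I) (λ _ r → r)) (range 1 (n ∸ 1)))
      ≈⟨ prodP-map-focus {F = hatFactor (ℓ ∷ I) (λ _ r → r)} {G = hatFactor I (shiftAbove ℓ)} g
           (λ v v≢ℓ → cong₂ (λ b r → if b ∧ not (D v) then eZ r else 1P) (hatᵇ-∷-≢ {n} I v≢ℓ) (rA-∷ v))
           hatFactor-ℓ (range 1 (n ∸ 1)) mult-ℓ-interior ⟩
    g *P prodP (map (hatFactor I (shiftAbove ℓ)) (range 1 (n ∸ 1)))
      ≈⟨ *-congˡ g (Poly.sym (prodP-filterᵇ (λ i → eZ (shiftAbove ℓ i (rA n I i))) (λ i → hatᵇ n I i ∧ not (D i))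
                                            (range 1 (n ∸ 1)))) ⟩
    g *P prodR-Î∖D n I D (shiftAbove ℓ) ∎

  I∖Î-same : prodR-I∖Î n (ℓ ∷ I) (λ _ r → r) ≡ prodR-I∖Î n I (shiftAbove ℓ)
  I∖Î-same = cong prodP (ListP.map-cong factor≡ (range 0 n))
    where
    factor≡ : ∀ v → powP (eZ (rB n (ℓ ∷ I) v)) (mult v (ℓ ∷ I) ∸ bit (hatᵇ n (ℓ ∷ I) v))
                  ≡ powP (eZ (shiftAbove ℓ v (rB n I v))) (mult v I ∸ bit (hatᵇ n I v))
    factor≡ v with v ℕ.≟ ℓ
    ... | no v≢ℓ   = cong₂ (λ r k → powP (eZ r) k) (rB-∷ v v≢ℓ)
                           (cong₂ (λ m b → m ∸ bit b) (mult-∷-≢ I v≢ℓ) (hatᵇ-∷-≢ {n} I v≢ℓ))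
    ... | yes refl = trans (cong (powP (eZ (rB n (ℓ ∷ I) ℓ)))
                                 (cong₂ (λ m b → m ∸ bit b) (trans (mult-∷-≡ {ℓ} I refl) (cong suc mult-ℓ-I)) ℓ∈Ĩ))
                           (sym (cong (powP (eZ (shiftAbove ℓ ℓ (rB n I ℓ)))) (cong₂ (λ m b → m ∸ bit b) mult-ℓ-I ℓ∉Î)))

CochIn : (n : ℕ) → (ℕ → Bool) → Set
CochIn n P = Σ (Coch n) λ C → DspSub C P

summandR : {n : ℕ} → List ℕ → (ℕ → ℤ → ℤ) → Coch n → Subsp n
summandR {n} I f C = mulSp (prodR n I (dspᵇ C) f) (VC C)

summandH : {n : ℕ} → List ℕ → Coch n → Subsp n
summandH {n} I C = mulSp (prodH n I (dspᵇ C)) (VC C)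

DspSub-∌ : {n k : ℕ} {P : ℕ → Bool} (C : Coch n) → DspSub C P → P k ≡ false → dspᵇ C k ≡ false
DspSub-∌ {k = k} C C⊆P Pk with dspᵇ C k in k∈C
... | false = refl
... | true  = contradiction (trans (sym (C⊆P k k∈C)) Pk) λ ()

DspSub-∷⁺ : {n ℓ : ℕ} {I : List ℕ} (C : Coch n) → DspSub C (hatᵇ n I) → DspSub C (hatᵇ n (ℓ ∷ I))
DspSub-∷⁺ {n} {ℓ} {I} C C⊆Î k k∈C = hatᵇ-∷-mono {n} {ℓ} {k} I (C⊆Î k k∈C)

DspSub-∷⁻ : {n ℓ : ℕ} {I : List ℕ} (C : Coch n) → DspSub C (hatᵇ n (ℓ ∷ I)) → dspᵇ C ℓ ≡ false → DspSub C (hatᵇ n I)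
DspSub-∷⁻ {n} {ℓ} {I} C C⊆Ĩ ℓ∉C k k∈C with k ℕ.≟ ℓ
... | no k≢ℓ   = trans (sym (hatᵇ-∷-≢ {n} I k≢ℓ)) (C⊆Ĩ k k∈C)
... | yes refl = contradiction (trans (sym k∈C) ℓ∉C) λ ()

SumSp-CochIn-cong : {n : ℕ} {P Q : ℕ → Bool} {V W : Coch n → Subsp n} → (∀ k → P k ≡ Q k) →
  (∀ C → DspSub C Q → V C ≐ W C) → SumSp {A = CochIn n P} (V ∘ proj₁) ≐ SumSp {A = CochIn n Q} (W ∘ proj₁)
SumSp-CochIn-cong P≗Q V≐W = ⊆-antisym
  (SumSp-mono λ { (C , C⊆P) → (C , C⊆Q C C⊆P) , λ p → proj₁ (V≐W C (C⊆Q C C⊆P) p) })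
  (SumSp-mono λ { (C , C⊆Q) → (C , λ k k∈C → trans (P≗Q k) (C⊆Q k k∈C)) , λ p → proj₂ (V≐W C C⊆Q p) })
  where
  C⊆Q : ∀ C → DspSub C _ → DspSub C _
  C⊆Q C C⊆P k k∈C = trans (sym (P≗Q k)) (C⊆P k k∈C)

mulSp-factor : {n : ℕ} {g h g′ : Pol n} {V : Subsp n} → g′ ≋ g *P h → mulSp g′ V ≐ mulSp g (mulSp h V)
mulSp-factor {g = g} {h} g′≋gh =
  ≐-trans (⊆-antisym (mulSp-resp-≋ g′≋gh) (mulSp-resp-≋ (Poly.sym g′≋gh))) (mulSp-*P {g = g} {h})

summandH-∷ : {n ℓ : ℕ} {I : List ℕ} → ℓ ≤ n → (C : Coch n) → DspSub C (hatᵇ n I) →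
  summandH (ℓ ∷ I) C ≐ mulSp (e ℓ) (summandH I C)
summandH-∷ {n} {ℓ} {I} ℓ≤n C C⊆Î =
  mulSp-factor {g = e ℓ} {h = prodH n I (dspᵇ C)} (prodH-∷ I (dspᵇ C) ℓ≤n (hatᵇ⇒mult {n} {I} {ℓ} ∘ C⊆Î ℓ))

module _ {n ℓ : ℕ} {I : List ℕ} where

  R-∷-Î-unchanged : ℓ ≤ n → (∀ v → hatᵇ n (ℓ ∷ I) v ≡ hatᵇ n I v) → R n (ℓ ∷ I) ≐ mulSp (eZ (rB n I ℓ)) (R n I)
  R-∷-Î-unchanged ℓ≤n Ĩ≗Î = ≐-trans
    (SumSp-CochIn-cong Ĩ≗Î λ C _ → mulSp-factor {g = eZ (rB n I ℓ)} {h = prodR n I (dspᵇ C) (λ _ r → r)}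
                                                 (prodR-∷-unchanged (dspᵇ C) (λ _ r → r) ℓ≤n Ĩ≗Î))
    (≐-sym (mulSp-SumSp {g = eZ (rB n I ℓ)} {V = summandR I (λ _ r → r) ∘ proj₁}))

  Rhom-∷-Î-unchanged : ℓ ≤ n → (∀ v → hatᵇ n (ℓ ∷ I) v ≡ hatᵇ n I v) → Rhom n (ℓ ∷ I) ≐ mulSp (e ℓ) (Rhom n I)
  Rhom-∷-Î-unchanged ℓ≤n Ĩ≗Î = ≐-trans (SumSp-CochIn-cong Ĩ≗Î (summandH-∷ ℓ≤n))
                                         (≐-sym (mulSp-SumSp {g = e ℓ} {V = summandH I ∘ proj₁}))

  module _ (1≤ℓ : 1 ≤ ℓ) (ℓ<n : ℓ < n) (ℓ∉Î : hatᵇ n I ℓ ≡ false) where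

    CochNew : Set
    CochNew = Σ (Coch n) λ C → (dspᵇ C ℓ ≡ true) × DspSub C (hatᵇ n (ℓ ∷ I))

    CochNew⊆ : (V : Coch n → Subsp n) →
      SumSp {A = CochNew} (V ∘ proj₁) ⊆ SumSp {A = CochIn n (hatᵇ n (ℓ ∷ I))} (V ∘ proj₁)
    CochNew⊆ V = SumSp-mono λ { (C , _ , C⊆Ĩ) → (C , C⊆Ĩ) , λ p p∈ → p∈ }

    Rhom-∷-Î-grows : Rhom n (ℓ ∷ I) ≐ (mulSp (e ℓ) (Rhom n I) ⊕ SumSp {A = CochNew} (summandH (ℓ ∷ I) ∘ proj₁))
    Rhom-∷-Î-grows = SumSp-split (mulSp-isAddSubmonoid {g = e ℓ} (SumSp-isAddSubmonoid {V = summandH I ∘ proj₁}))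
                                 SumSp-isAddSubmonoid classify
      (λ p p∈ → SumSp-mono (λ { (C , C⊆Î) → (C , DspSub-∷⁺ C C⊆Î) , λ q → proj₂ (summandH-∷ (ℕP.<⇒≤ ℓ<n) C C⊆Î q) })
                           p (proj₁ (mulSp-SumSp {g = e ℓ} {V = summandH I ∘ proj₁} p) p∈))
      (CochNew⊆ (summandH (ℓ ∷ I)))
      where
      classify : (a : CochIn n (hatᵇ n (ℓ ∷ I))) →
        summandH (ℓ ∷ I) (proj₁ a) ⊆ mulSp (e ℓ) (Rhom n I)
        ⊎ summandH (ℓ ∷ I) (proj₁ a) ⊆ SumSp {A = CochNew} (summandH (ℓ ∷ I) ∘ proj₁)
      classify (C , C⊆Ĩ) with dspᵇ C ℓ in ℓ∈C
      ... | true  = inj₂ (⊆-SumSp (C , ℓ∈C , C⊆Ĩ))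
      ... | false = inj₁ λ p p∈ → mulSp-mono {g = e ℓ} (⊆-SumSp {V = summandH I ∘ proj₁} (C , C⊆Î)) p
                                            (proj₁ (summandH-∷ (ℕP.<⇒≤ ℓ<n) C C⊆Î p) p∈)
        where C⊆Î = DspSub-∷⁻ C C⊆Ĩ ℓ∈C

    R-∷-Î-grows : R n (ℓ ∷ I) ≐
      (SumSp {A = CochNew} (summandR (ℓ ∷ I) (λ _ r → r) ∘ proj₁)
       ⊕ SumSp {A = CochIn n (hatᵇ n I)} λ a →
           mulSp (eZ (rA n I ℓ) *P prodR n I (dspᵇ (proj₁ a)) (shiftAbove ℓ)) (VC (proj₁ a)))
    R-∷-Î-grows = SumSp-split SumSp-isAddSubmonoid SumSp-isAddSubmonoid classify
      (CochNew⊆ (summandR (ℓ ∷ I) (λ _ r → r)))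
      (SumSp-mono λ { (C , C⊆Î) → (C , DspSub-∷⁺ C C⊆Î) ,
                                  mulSp-resp-≋ (Poly.sym (prodR-∷-new (dspᵇ C) 1≤ℓ ℓ<n ℓ∉Î (DspSub-∌ C C⊆Î ℓ∉Î))) })
      where
      classify : (a : CochIn n (hatᵇ n (ℓ ∷ I))) → _ ⊎ _
      classify (C , C⊆Ĩ) with dspᵇ C ℓ in ℓ∈C
      ... | true  = inj₁ (⊆-SumSp (C , ℓ∈C , C⊆Ĩ))
      ... | false = inj₂ λ p p∈ → ⊆-SumSp (C , DspSub-∷⁻ C C⊆Ĩ ℓ∈C) p
                                          (mulSp-resp-≋ (prodR-∷-new (dspᵇ C) 1≤ℓ ℓ<n ℓ∉Î ℓ∈C) p p∈)

proposition3p4 : (n : ℕ) (I : List ℕ) → All (_≤ n) I → (ℓ : ℕ) → ℓ ≤ n →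
    -- (i)
    ((hatᵇ n I ℓ ≡ true ⊎ ℓ ≡ 0 ⊎ ℓ ≡ n) →
      (R n (ℓ ∷ I) ≐ mulSp (eZ (rB n I ℓ)) (R n I))
      × (Rhom n (ℓ ∷ I) ≐ mulSp (e ℓ) (Rhom n I)))
    × (1 ≤ ℓ → ℓ < n → hatᵇ n I ℓ ≡ false →
      -- (ii)
      (Rhom n (ℓ ∷ I) ≐
        (mulSp (e ℓ) (Rhom n I)
         ⊕ SumSp {A = Σ (Coch n) λ C → (dspᵇ C ℓ ≡ true) × DspSub C (hatᵇ n (ℓ ∷ I))}
                 (λ a → mulSp (prodH n (ℓ ∷ I) (dspᵇ (proj₁ a))) (VC (proj₁ a)))))
      -- (iii)
      × (R n (ℓ ∷ I) ≐
        (SumSp {A = Σ (Coch n) λ C → (dspᵇ C ℓ ≡ true) × DspSub C (hatᵇ n (ℓ ∷ I))}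
               (λ a → mulSp (prodR n (ℓ ∷ I) (dspᵇ (proj₁ a)) (λ _ r → r)) (VC (proj₁ a)))
         ⊕ SumSp {A = Σ (Coch n) λ C → DspSub C (hatᵇ n I)}
                 (λ a → mulSp (eZ (rA n I ℓ) *P prodR n I (dspᵇ (proj₁ a)) (λ i r → if ℓ <ᵇ i then r - + 1 else r))
                              (VC (proj₁ a))))))
proposition3p4 n I _ ℓ ℓ≤n =
  (λ case → R-∷-Î-unchanged ℓ≤n (hatᵇ-∷-unchanged case) , Rhom-∷-Î-unchanged ℓ≤n (hatᵇ-∷-unchanged case)) ,
  (λ 1≤ℓ ℓ<n ℓ∉Î → Rhom-∷-Î-grows 1≤ℓ ℓ<n ℓ∉Î , R-∷-Î-grows 1≤ℓ ℓ<n ℓ∉Î)
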